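{- Let $n\geq 1$ and let $q=(q_1,\ldots,q_n)$ be a sequence of positive integers. Set $Q:=1+q_1+\cdots+q_n$ and \[ T_q:=\left\{b\in\{1,\ldots,Q-1\} \,:\, Q\nmid q_ib \text{ for all } i\in\{1,\ldots,n\}\right\}. \] Then the local $h^\ast$-polynomial of the $n$-simplex $\Delta_{(1,q)}$ is \[ \ell^\ast(\Delta_{(1,q)};z)=\sum_{b\in T_q} z^{\omega(b)},\qquad \text{where}\qquad \omega(b)=b-\sum_{i=1}^n\left\lfloor \frac{q_ib}{Q}\right\rfloor . \]
   Context: Let $e^{(1)},\ldots,e^{(n)}$ be the standard basis vectors of $\mathbb{R}^n$. For a sequence of positive integers $q=(q_1,\ldots,q_n)$, define the lattice $n$-simplex $\Delta_{(1,q)}:=\operatorname{conv}\left(e^{(1)},\ldots,e^{(n)},-\sum_{i=1}^n q_ie^{(i)}\right)\subset\mathbb{R}^n$. For a lattice $d$-simplex $\Delta=\operatorname{conv}(v^{(0)},\ldots,v^{(d)})\subset\mathbb{R}^n$ (vertices in $\mathbb{Z}^n$, affinely independent), its open parallelepiped is $\Pi^\circ_\Delta:=\{\sum_{i=0}^d\lambda_i(v^{(i)},1)\in\mathbb{R}^{n+1} : 0<\lambda_i<1 \text{ for all } i\}$, and its local $h^\ast$-polynomial (box polynomial) is $\ell^\ast(\Delta;z):=\sum_{(x_1,\ldots,x_{n+1})\in\Pi^\circ_\Delta\cap\mathbb{Z}^{n+1}} z^{x_{n+1}}$.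
   Formalization: The coefficients $\lambda_i$ in the open parallelepiped $\Pi^\circ_\Delta$ are taken in ℚ rather than ℝ. -}

module Defs where

open import Data.Bool using (if_then_else_)
open import Data.Nat as ℕ using (ℕ; zero; suc; _∸_)
open import Data.Nat.DivMod using (_/_)
open import Data.Nat.Divisibility using (_∣_)
open import Data.Integer as ℤ using (ℤ; +_)
open import Data.Rational as ℚ using (ℚ; 0ℚ; 1ℚ)
open import Data.Fin using (Fin; zero; suc; _≟_)
open import Data.Vec using (Vec; tabulate; lookup; _∷ʳ_)
open import Data.Product using (Σ; Σ-syntax; _×_)
open import Relation.Nullary using (¬_; does)
open import Relation.Binary.PropositionalEquality using (_≡_)

sumℚ : ∀ k → (Fin k → ℚ) → ℚ
sumℚ zero f = 0ℚ
sumℚ (suc k) f = f zero ℚ.+ sumℚ k (λ i → f (suc i))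

sumℕ : ∀ k → (Fin k → ℕ) → ℕ
sumℕ zero f = 0
sumℕ (suc k) f = f zero ℕ.+ sumℕ k (λ i → f (suc i))

toℚ : ℤ → ℚ
toℚ z = z ℚ./ 1

lift1 : ∀ {m} → Vec ℤ m → Vec ℤ (suc m)
lift1 v = v ∷ʳ ℤ.1ℤ

-- A lattice d-simplex in ℝ^m is given by its d+1 vertices v : Fin (suc d) → ℤ^m.
-- x ∈ ℤ^{m+1} lies in the open parallelepiped Π°_Δ iff
-- x = Σ_i λ_i (v_i , 1) with 0 < λ_i < 1.  (The λ_i are taken rational; for an
-- integer point and affinely independent vertices the real coefficients are
-- unique and automatically rational.)
InOpenParallelepiped : ∀ {d m} → (Fin (suc d) → Vec ℤ m) → Vec ℤ (suc m) → Set
InOpenParallelepiped {d} {m} v x =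
  Σ[ λs ∈ (Fin (suc d) → ℚ) ]
    ((∀ i → (0ℚ ℚ.< λs i) × (λs i ℚ.< 1ℚ)) ×
     (∀ j → toℚ (lookup x j) ≡ sumℚ (suc d) (λ i → λs i ℚ.* toℚ (lookup (lift1 (v i)) j))))

basis : ∀ {n} → Fin n → Vec ℤ n
basis i = tabulate (λ j → if does (i ≟ j) then ℤ.1ℤ else ℤ.0ℤ)

-- vertices of Δ_(1,q): vertex 0 is -Σ q_i e^(i), vertex (1+i) is e^(i)
-- (the ordering of the vertices does not affect Π°).
Δ1q : ∀ {n} → (Fin n → ℕ) → Fin (suc n) → Vec ℤ n
Δ1q q zero = tabulate (λ j → ℤ.- (+ q j))
Δ1q q (suc i) = basis i

Qof : ∀ {n} → (Fin n → ℕ) → ℕ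
Qof {n} q = suc (sumℕ n q)

InT : ∀ {n} → (Fin n → ℕ) → ℕ → Set
InT q b = (1 ℕ.≤ b) × (b ℕ.< Qof q) × (∀ i → ¬ (Qof q ∣ q i ℕ.* b))

ω : ∀ {n} → (Fin n → ℕ) → ℕ → ℕ
ω {n} q b = b ∸ sumℕ n (λ i → (q i ℕ.* b) / Qof q)

-- ℓ*(Δ; z) = Σ_{b ∈ T} z^{w b}, i.e. equality of the two generating
-- polynomials, expressed as a degree-preserving bijection g between T and
-- Π°_Δ ∩ ℤ^{m+1} (degree of a lattice point x = its last coordinate).
LocalHStarEq : ∀ {d m} → (Fin (suc d) → Vec ℤ m) → (T : ℕ → Set) → (w : ℕ → ℕ) → Set
LocalHStarEq {d} {m} v T w =
  Σ[ g ∈ (ℕ → Vec ℤ (suc m)) ]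
    ((∀ b → T b → InOpenParallelepiped v (g b) × (lookup (g b) (Data.Fin.fromℕ m) ≡ + w b)) ×
     (∀ b b′ → T b → T b′ → g b ≡ g b′ → b ≡ b′) ×
     (∀ x → InOpenParallelepiped v x → Σ[ b ∈ ℕ ] (T b × (g b ≡ x))))

-- Write the lattice point of Π° with barycentric weights λ as (X, L) ∈ ℤⁿ × ℤ. Its coordinates
-- are Xⱼ = λⱼ₊₁ − qⱼ λ₀ and L = Σ λ, so Q λ₀ = L − Σ Xⱼ =: b is an integer in (0, Q), and then
-- Q λⱼ₊₁ = Q Xⱼ + qⱼ b is an integer in (0, Q). Hence Q λⱼ₊₁ is the remainder of qⱼ b modulo Q,
-- which must be nonzero, Xⱼ = −⌊qⱼ b / Q⌋ and L = b − Σ ⌊qⱼ b / Q⌋ = ω(b). Conversely every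
-- b ∈ T_q yields the weights (b / Q, (qⱼ b mod Q) / Q), which lie in (0, 1).
module Submission where

open import Algebra.Bundles using (CommutativeRing)
import Algebra.Properties.Semiring.Sum as SemiringSum
open import Data.Empty using (⊥-elim)
open import Data.Fin using (Fin; zero; suc; inject₁; fromℕ)
open import Data.Fin.Relation.Unary.Top using (view; ‵fromℕ; ‵inject₁)
open import Data.Integer as ℤ using (ℤ; +_; +[1+_]; -[1+_]; +<+; _⊖_)
import Data.Integer.Properties as ℤP
open import Data.Integer.Solver using () renaming (module +-*-Solver to ℤ-Solver)
open import Data.Nat as ℕ using (ℕ; zero; suc; z≤n; s≤s; _≤_; NonZero)
import Data.Nat.Properties as ℕP
open import Data.Nat.Coprimality using (Coprime; 1-coprimeTo)
open import Data.Nat.DivMod using (_/_; _%_; m≡m%n+[m/n]*n; m%n<n)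
open import Data.Nat.Divisibility using (_∣_; m%n≡0⇒n∣m; n∣m⇒m%n≡0)
open import Data.Product using (Σ-syntax; _×_; _,_; proj₁; proj₂)
open import Data.Rational as ℚ using (ℚ; mkℚ; 0ℚ; 1ℚ; _÷_)
import Data.Rational.Properties as ℚP
open import Data.Rational.Solver using () renaming (module +-*-Solver to ℚ-Solver)
open import Data.Vec using (Vec; []; _∷_; lookup; tabulate; _∷ʳ_)
open import Data.Vec.Properties using (lookup∘tabulate; tabulate∘lookup; tabulate-cong)
open import Function using (_∘_)
open import Relation.Binary.PropositionalEquality
  using (_≡_; _≗_; refl; cong; cong₂; sym; trans; subst; subst₂; module ≡-Reasoning)
open import Relation.Nullary using (¬_)

open import Defs

coprimeTo1 : ∀ n → Coprime n 1
coprimeTo1 n = Data.Nat.Coprimality.sym (1-coprimeTo n)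

toℚ≡mkℚ : ∀ z → toℚ z ≡ mkℚ z 0 (coprimeTo1 ℤ.∣ z ∣)
toℚ≡mkℚ (+ n)    = ℚP.normalize-coprime (coprimeTo1 n)
toℚ≡mkℚ -[1+ n ] = cong ℚ.-_ (ℚP.normalize-coprime (coprimeTo1 (suc n)))

toℚ-injective : ∀ {a b} → toℚ a ≡ toℚ b → a ≡ b
toℚ-injective {a} {b} eq = cong ℚ.numerator (trans (sym (toℚ≡mkℚ a)) (trans eq (toℚ≡mkℚ b)))

toℚ-homo-+ : ∀ a b → toℚ (a ℤ.+ b) ≡ toℚ a ℚ.+ toℚ b
toℚ-homo-+ a b rewrite toℚ≡mkℚ a | toℚ≡mkℚ b =
  ℚP./-cong (cong₂ ℤ._+_ (sym (ℤP.*-identityʳ a)) (sym (ℤP.*-identityʳ b))) refl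

toℚ-homo-* : ∀ a b → toℚ (a ℤ.* b) ≡ toℚ a ℚ.* toℚ b
toℚ-homo-* a b rewrite toℚ≡mkℚ a | toℚ≡mkℚ b = refl

toℚ-homo‿- : ∀ a → toℚ (ℤ.- a) ≡ ℚ.- toℚ a
toℚ-homo‿- a rewrite toℚ≡mkℚ a | toℚ≡mkℚ (ℤ.- a) with a
... | + zero   = refl
... | +[1+ n ] = refl
... | -[1+ n ] = refl

toℚ-mono-< : ∀ {a b} → a ℤ.< b → toℚ a ℚ.< toℚ b
toℚ-mono-< {a} {b} a<b rewrite toℚ≡mkℚ a | toℚ≡mkℚ b =
  ℚ.*<* (subst₂ ℤ._<_ (sym (ℤP.*-identityʳ a)) (sym (ℤP.*-identityʳ b)) a<b)

toℚ-cancel-< : ∀ {a b} → toℚ a ℚ.< toℚ b → a ℤ.< b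
toℚ-cancel-< {a} {b} a<b rewrite toℚ≡mkℚ a | toℚ≡mkℚ b with a<b
... | ℚ.*<* a*1<b*1 = subst₂ ℤ._<_ (ℤP.*-identityʳ a) (ℤP.*-identityʳ b) a*1<b*1

module ℕΣ = SemiringSum ℕP.+-*-semiring
module ℤΣ = SemiringSum ℤP.+-*-semiring
module ℚΣ = SemiringSum (CommutativeRing.semiring ℚP.+-*-commutativeRing)

sumℕ≡∑ : ∀ k (f : Fin k → ℕ) → sumℕ k f ≡ ℕΣ.sum f
sumℕ≡∑ zero    f = refl
sumℕ≡∑ (suc k) f = cong (f zero ℕ.+_) (sumℕ≡∑ k (f ∘ suc))

sumℚ≡∑ : ∀ k (f : Fin k → ℚ) → sumℚ k f ≡ ℚΣ.sum f
sumℚ≡∑ zero    f = refl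
sumℚ≡∑ (suc k) f = cong (f zero ℚ.+_) (sumℚ≡∑ k (f ∘ suc))

sumℕ-cong : ∀ k {f g : Fin k → ℕ} → f ≗ g → sumℕ k f ≡ sumℕ k g
sumℕ-cong k {f} {g} f≗g = trans (sumℕ≡∑ k f) (trans (ℕΣ.sum-cong-≗ f≗g) (sym (sumℕ≡∑ k g)))

sumℚ-cong : ∀ k {f g : Fin k → ℚ} → f ≗ g → sumℚ k f ≡ sumℚ k g
sumℚ-cong k {f} {g} f≗g = trans (sumℚ≡∑ k f) (trans (ℚΣ.sum-cong-≗ f≗g) (sym (sumℚ≡∑ k g)))

sumℚ-+ : ∀ k (f g : Fin k → ℚ) → sumℚ k (λ i → f i ℚ.+ g i) ≡ sumℚ k f ℚ.+ sumℚ k g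
sumℚ-+ k f g = begin
  sumℚ k (λ i → f i ℚ.+ g i)  ≡⟨ sumℚ≡∑ k (λ i → f i ℚ.+ g i) ⟩
  ℚΣ.sum (λ i → f i ℚ.+ g i)  ≡⟨ ℚΣ.∑-distrib-+ f g ⟩
  ℚΣ.sum f ℚ.+ ℚΣ.sum g       ≡⟨ sym (cong₂ ℚ._+_ (sumℚ≡∑ k f) (sumℚ≡∑ k g)) ⟩
  sumℚ k f ℚ.+ sumℚ k g       ∎
  where open ≡-Reasoning

sumℚ-*ʳ : ∀ k (f : Fin k → ℚ) c → sumℚ k f ℚ.* c ≡ sumℚ k (λ i → f i ℚ.* c)
sumℚ-*ʳ k f c = begin
  sumℚ k f ℚ.* c              ≡⟨ cong (ℚ._* c) (sumℚ≡∑ k f) ⟩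
  ℚΣ.sum f ℚ.* c              ≡⟨ ℚΣ.*-distribʳ-sum c f ⟩
  ℚΣ.sum (λ i → f i ℚ.* c)    ≡⟨ sym (sumℚ≡∑ k (λ i → f i ℚ.* c)) ⟩
  sumℚ k (λ i → f i ℚ.* c)    ∎
  where open ≡-Reasoning

toℚ-homo-∑ : ∀ k (f : Fin k → ℤ) → toℚ (ℤΣ.sum f) ≡ sumℚ k (toℚ ∘ f)
toℚ-homo-∑ zero    f = refl
toℚ-homo-∑ (suc k) f = trans (toℚ-homo-+ (f zero) _) (cong (toℚ (f zero) ℚ.+_) (toℚ-homo-∑ k (f ∘ suc)))

toℚ-homo-sumℕ : ∀ k (f : Fin k → ℕ) → toℚ (+ sumℕ k f) ≡ sumℚ k (λ i → toℚ (+ f i))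
toℚ-homo-sumℕ zero    f = refl
toℚ-homo-sumℕ (suc k) f = trans (toℚ-homo-+ (+ f zero) (+ sumℕ k (f ∘ suc)))
  (cong (toℚ (+ f zero) ℚ.+_) (toℚ-homo-sumℕ k (f ∘ suc)))

module _ (K : ℚ) .{{_ : ℚ.Positive K}} where
  private instance
    K≢0 : ℚ.NonZero K
    K≢0 = ℚP.pos⇒nonZero K
    K⁻¹>0 : ℚ.Positive (ℚ.1/ K)
    K⁻¹>0 = ℚP.1/pos⇒pos K

  *-÷-cancel : ∀ p → p ℚ.* K ÷ K ≡ p
  *-÷-cancel p = begin
    p ℚ.* K ℚ.* ℚ.1/ K   ≡⟨ ℚP.*-assoc p K (ℚ.1/ K) ⟩
    p ℚ.* (K ℚ.* ℚ.1/ K) ≡⟨ cong (p ℚ.*_) (ℚP.*-inverseʳ K) ⟩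
    p ℚ.* 1ℚ             ≡⟨ ℚP.*-identityʳ p ⟩
    p                    ∎
    where open ≡-Reasoning

  *≡⇒≡÷ : ∀ {μ p} → μ ℚ.* K ≡ p → μ ≡ p ÷ K
  *≡⇒≡÷ {μ} eq = trans (sym (*-÷-cancel μ)) (cong (_÷ K) eq)

  0<p<K⇒0<p÷K<1 : ∀ {p} → 0ℚ ℚ.< p → p ℚ.< K → (0ℚ ℚ.< p ÷ K) × (p ÷ K ℚ.< 1ℚ)
  0<p<K⇒0<p÷K<1 {p} 0<p p<K =
    subst (ℚ._< p ÷ K) (ℚP.*-zeroˡ (ℚ.1/ K)) (ℚP.*-monoˡ-<-pos (ℚ.1/ K) 0<p) ,
    subst (p ÷ K ℚ.<_) (ℚP.*-inverseʳ K) (ℚP.*-monoˡ-<-pos (ℚ.1/ K) p<K)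

  0<μ<1⇒0<μ*K<K : ∀ {μ} → 0ℚ ℚ.< μ → μ ℚ.< 1ℚ → (0ℚ ℚ.< μ ℚ.* K) × (μ ℚ.* K ℚ.< K)
  0<μ<1⇒0<μ*K<K {μ} 0<μ μ<1 =
    subst (ℚ._< μ ℚ.* K) (ℚP.*-zeroˡ K) (ℚP.*-monoˡ-<-pos K 0<μ) ,
    subst (μ ℚ.* K ℚ.<_) (ℚP.*-identityˡ K) (ℚP.*-monoˡ-<-pos K μ<1)

quotient-zero : ∀ Q (Y : ℤ) {r} → r ℕ.< Q →
                + 0 ℤ.≤ Y ℤ.* + Q ℤ.+ + r → Y ℤ.* + Q ℤ.+ + r ℤ.< + Q → Y ≡ + 0
quotient-zero zero    Y        ()
quotient-zero (suc S) (+ zero) r<Q 0≤z z<Q = refl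
quotient-zero (suc S) +[1+ k ] {r} r<Q 0≤z z<Q =
  ⊥-elim (ℕP.<⇒≱ (ℤP.drop‿+<+ z<Q) (s≤s (ℕP.≤-trans (ℕP.m≤m+n S (k ℕ.* suc S)) (ℕP.m≤m+n _ r))))
quotient-zero (suc S) -[1+ k ] {r} r<Q 0≤z z<Q =
  ⊥-elim (ℤP.<⇒≱ (subst (r ⊖ suc (S ℕ.+ k ℕ.* suc S) ℤ.<_) (ℤP.n⊖n≡0 r) (ℤP.⊖-monoʳ->-< r r<a)) 0≤z)
  where
  r<a : r ℕ.< suc (S ℕ.+ k ℕ.* suc S)
  r<a = ℕP.<-≤-trans r<Q (s≤s (ℕP.m≤m+n S (k ℕ.* suc S)))

+-division : ∀ m Q .{{_ : NonZero Q}} → + m ≡ + (m % Q) ℤ.+ + (m / Q) ℤ.* + Q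
+-division m Q = trans (cong +_ (m≡m%n+[m/n]*n m Q))
  (trans (ℤP.pos-+ (m % Q) _) (cong (λ t → + (m % Q) ℤ.+ t) (ℤP.pos-* (m / Q) Q)))

remainder-unique : ∀ (X : ℤ) m Q .{{_ : NonZero Q}} → + 0 ℤ.≤ X ℤ.* + Q ℤ.+ + m →
                   X ℤ.* + Q ℤ.+ + m ℤ.< + Q → X ℤ.* + Q ℤ.+ + m ≡ + (m % Q)
remainder-unique X m Q 0≤z z<Q = trans z≡ (cong (λ Y → Y ℤ.* + Q ℤ.+ + (m % Q)) Y≡0)
  where
  z≡ : X ℤ.* + Q ℤ.+ + m ≡ (X ℤ.+ + (m / Q)) ℤ.* + Q ℤ.+ + (m % Q)
  z≡ = trans (cong (λ t → X ℤ.* + Q ℤ.+ t) (+-division m Q))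
    (solve 4 (λ x r f q → x :* q :+ (r :+ f :* q) := (x :+ f) :* q :+ r) refl X (+ (m % Q)) (+ (m / Q)) (+ Q))
    where open ℤ-Solver
  Y≡0 : X ℤ.+ + (m / Q) ≡ + 0
  Y≡0 = quotient-zero Q _ (m%n<n m Q) (subst (+ 0 ℤ.≤_) z≡ 0≤z) (subst (ℤ._< + Q) z≡ z<Q)

lookup-∷ʳ-inject₁ : ∀ {A : Set} {k} (xs : Vec A k) y j → lookup (xs ∷ʳ y) (inject₁ j) ≡ lookup xs j
lookup-∷ʳ-inject₁ (x ∷ xs) y zero    = refl
lookup-∷ʳ-inject₁ (x ∷ xs) y (suc j) = lookup-∷ʳ-inject₁ xs y j

lookup-∷ʳ-fromℕ : ∀ {A : Set} {k} (xs : Vec A k) y → lookup (xs ∷ʳ y) (fromℕ k) ≡ y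
lookup-∷ʳ-fromℕ []       y = refl
lookup-∷ʳ-fromℕ (x ∷ xs) y = lookup-∷ʳ-fromℕ xs y

combination : ∀ {d m} → (Fin (suc d) → Vec ℤ m) → (Fin (suc d) → ℚ) → Fin (suc m) → ℚ
combination {d} v λs j = sumℚ (suc d) (λ i → λs i ℚ.* toℚ (lookup (lift1 (v i)) j))

IsCombination : ∀ {d m} → (Fin (suc d) → Vec ℤ m) → (Fin (suc d) → ℚ) → Vec ℤ (suc m) → Set
IsCombination v λs x = ∀ j → toℚ (lookup x j) ≡ combination v λs j

combination-cong : ∀ {d m} (v : Fin (suc d) → Vec ℤ m) {λs μs} → λs ≗ μs → combination v λs ≗ combination v μs
combination-cong {d} v λs≗μs j = sumℚ-cong (suc d) (λ i → cong (ℚ._* toℚ (lookup (lift1 (v i)) j)) (λs≗μs i))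

combination-last : ∀ {d m} (v : Fin (suc d) → Vec ℤ m) λs → combination v λs (fromℕ m) ≡ sumℚ (suc d) λs
combination-last {d} {m} v λs = sumℚ-cong (suc d) coefficient
  where
  coefficient : ∀ i → λs i ℚ.* toℚ (lookup (lift1 (v i)) (fromℕ m)) ≡ λs i
  coefficient i = trans (cong (λ z → λs i ℚ.* toℚ z) (lookup-∷ʳ-fromℕ (v i) ℤ.1ℤ)) (ℚP.*-identityʳ (λs i))

IsCombination-unique : ∀ {d m} (v : Fin (suc d) → Vec ℤ m) λs {x y} →
                       IsCombination v λs x → IsCombination v λs y → x ≡ y
IsCombination-unique v λs {x} {y} x≈ y≈ = begin
  x                    ≡⟨ sym (tabulate∘lookup x) ⟩
  tabulate (lookup x)  ≡⟨ tabulate-cong {f = lookup x} {g = lookup y} same-coordinates ⟩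
  tabulate (lookup y)  ≡⟨ tabulate∘lookup y ⟩
  y                    ∎
  where
  open ≡-Reasoning
  same-coordinates : lookup x ≗ lookup y
  same-coordinates j = toℚ-injective (trans (x≈ j) (sym (y≈ j)))

sumℚ-zero : ∀ k → sumℚ k (λ _ → 0ℚ) ≡ 0ℚ
sumℚ-zero k = trans (sumℚ≡∑ k (λ _ → 0ℚ)) (ℚΣ.sum-replicate-zero k)

sumℚ-*-basis : ∀ k (h : Fin k → ℚ) j → sumℚ k (λ i → h i ℚ.* toℚ (lookup (basis i) j)) ≡ h j
sumℚ-*-basis (suc k) h zero = begin
  h zero ℚ.* 1ℚ ℚ.+ sumℚ k (λ i → h (suc i) ℚ.* 0ℚ)
    ≡⟨ cong₂ ℚ._+_ (ℚP.*-identityʳ (h zero)) (trans (sumℚ-cong k (ℚP.*-zeroʳ ∘ h ∘ suc)) (sumℚ-zero k)) ⟩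
  h zero ℚ.+ 0ℚ
    ≡⟨ ℚP.+-identityʳ (h zero) ⟩
  h zero ∎
  where open ≡-Reasoning
sumℚ-*-basis (suc k) h (suc j) = begin
  h zero ℚ.* toℚ (lookup (basis zero) (suc j)) ℚ.+ sumℚ k (λ i → h (suc i) ℚ.* toℚ (lookup (basis i) j))
    ≡⟨ cong₂ ℚ._+_ h₀·0≡0 (sumℚ-*-basis k (h ∘ suc) j) ⟩
  0ℚ ℚ.+ h (suc j)
    ≡⟨ ℚP.+-identityˡ (h (suc j)) ⟩
  h (suc j) ∎
  where
  open ≡-Reasoning
  h₀·0≡0 : h zero ℚ.* toℚ (lookup (basis zero) (suc j)) ≡ 0ℚ
  h₀·0≡0 = trans (cong (λ z → h zero ℚ.* toℚ z) (lookup∘tabulate _ j)) (ℚP.*-zeroʳ (h zero))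

Δ1q-combination-inject₁ : ∀ {n} (q : Fin n → ℕ) λs j →
  combination (Δ1q q) λs (inject₁ j) ≡ λs (suc j) ℚ.- toℚ (+ q j) ℚ.* λs zero
Δ1q-combination-inject₁ {n} q λs j = begin
  λs zero ℚ.* toℚ (lookup (lift1 (Δ1q q zero)) (inject₁ j)) ℚ.+
    sumℚ n (λ i → λs (suc i) ℚ.* toℚ (lookup (lift1 (basis i)) (inject₁ j)))
    ≡⟨ cong₂ ℚ._+_ (cong (λ z → λs zero ℚ.* toℚ z) apex)
                   (sumℚ-cong n (λ i → cong (λ z → λs (suc i) ℚ.* toℚ z) (lookup-∷ʳ-inject₁ (basis i) ℤ.1ℤ j))) ⟩
  λs zero ℚ.* toℚ (ℤ.- + q j) ℚ.+ sumℚ n (λ i → λs (suc i) ℚ.* toℚ (lookup (basis i) j))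
    ≡⟨ cong₂ ℚ._+_ (cong (λs zero ℚ.*_) (toℚ-homo‿- (+ q j))) (sumℚ-*-basis n (λs ∘ suc) j) ⟩
  λs zero ℚ.* ℚ.- toℚ (+ q j) ℚ.+ λs (suc j)
    ≡⟨ solve 3 (λ l₀ l qj → l₀ :* (:- qj) :+ l := l :- qj :* l₀) refl (λs zero) (λs (suc j)) (toℚ (+ q j)) ⟩
  λs (suc j) ℚ.- toℚ (+ q j) ℚ.* λs zero ∎
  where
  open ≡-Reasoning
  open ℚ-Solver
  apex : lookup (lift1 (Δ1q q zero)) (inject₁ j) ≡ ℤ.- + q j
  apex = trans (lookup-∷ʳ-inject₁ (Δ1q q zero) ℤ.1ℤ j) (lookup∘tabulate _ j)

module _ {n : ℕ} (q : Fin n → ℕ) where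
  private
    S : ℕ
    S = sumℕ n q
    Q : ℕ
    Q = Qof q

  quot rem : ℕ → Fin n → ℕ
  quot b i = q i ℕ.* b / Q
  rem  b i = q i ℕ.* b % Q

  sum-division : ∀ b → sumℕ n (rem b) ℕ.+ sumℕ n (quot b) ℕ.* Q ≡ S ℕ.* b
  sum-division b = begin
    sumℕ n (rem b) ℕ.+ sumℕ n (quot b) ℕ.* Q
      ≡⟨ cong₂ (λ x y → x ℕ.+ y ℕ.* Q) (sumℕ≡∑ n (rem b)) (sumℕ≡∑ n (quot b)) ⟩
    ∑ (rem b) ℕ.+ ∑ (quot b) ℕ.* Q
      ≡⟨ cong (∑ (rem b) ℕ.+_) (ℕΣ.*-distribʳ-sum Q (quot b)) ⟩
    ∑ (rem b) ℕ.+ ∑ (λ i → quot b i ℕ.* Q)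
      ≡⟨ sym (ℕΣ.∑-distrib-+ (rem b) (λ i → quot b i ℕ.* Q)) ⟩
    ∑ (λ i → rem b i ℕ.+ quot b i ℕ.* Q)
      ≡⟨ ℕΣ.sum-cong-≗ (λ i → sym (m≡m%n+[m/n]*n (q i ℕ.* b) Q)) ⟩
    ∑ (λ i → q i ℕ.* b)
      ≡⟨ sym (ℕΣ.*-distribʳ-sum b q) ⟩
    ∑ q ℕ.* b
      ≡⟨ cong (ℕ._* b) (sym (sumℕ≡∑ n q)) ⟩
    S ℕ.* b ∎
    where
    open ≡-Reasoning
    ∑ : (Fin n → ℕ) → ℕ
    ∑ = ℕΣ.sum

  sum-quot≤ : ∀ b → sumℕ n (quot b) ℕ.≤ b
  sum-quot≤ b = ℕP.*-cancelʳ-≤ (sumℕ n (quot b)) b Q (begin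
    sumℕ n (quot b) ℕ.* Q                     ≤⟨ ℕP.m≤n+m _ (sumℕ n (rem b)) ⟩
    sumℕ n (rem b) ℕ.+ sumℕ n (quot b) ℕ.* Q  ≡⟨ sum-division b ⟩
    S ℕ.* b                                   ≤⟨ ℕP.m≤n+m (S ℕ.* b) b ⟩
    Q ℕ.* b                                   ≡⟨ ℕP.*-comm Q b ⟩
    b ℕ.* Q                                   ∎)
    where open ℕP.≤-Reasoning

  ω+sum-quot : ∀ b → ω q b ℕ.+ sumℕ n (quot b) ≡ b
  ω+sum-quot b = ℕP.m∸n+n≡m (sum-quot≤ b)

  Q*ω : ∀ b → Q ℕ.* ω q b ≡ b ℕ.+ sumℕ n (rem b)
  Q*ω b = ℕP.+-cancelʳ-≡ (sumℕ n (quot b) ℕ.* Q) _ _ (begin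
    Q ℕ.* ω q b ℕ.+ sumℕ n (quot b) ℕ.* Q            ≡⟨ cong (Q ℕ.* ω q b ℕ.+_) (ℕP.*-comm _ Q) ⟩
    Q ℕ.* ω q b ℕ.+ Q ℕ.* sumℕ n (quot b)            ≡⟨ sym (ℕP.*-distribˡ-+ Q (ω q b) _) ⟩
    Q ℕ.* (ω q b ℕ.+ sumℕ n (quot b))                ≡⟨ cong (Q ℕ.*_) (ω+sum-quot b) ⟩
    b ℕ.+ S ℕ.* b                                    ≡⟨ cong (b ℕ.+_) (sym (sum-division b)) ⟩
    b ℕ.+ (sumℕ n (rem b) ℕ.+ sumℕ n (quot b) ℕ.* Q)  ≡⟨ sym (ℕP.+-assoc b _ _) ⟩
    b ℕ.+ sumℕ n (rem b) ℕ.+ sumℕ n (quot b) ℕ.* Q    ∎)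
    where open ≡-Reasoning

  neg-quot*Q : ∀ b j → ℤ.- + quot b j ℤ.* + Q ≡ + rem b j ℤ.- + q j ℤ.* + b
  neg-quot*Q b j = begin
    ℤ.- + quot b j ℤ.* + Q
      ≡⟨ solve 3 (λ r f Q → :- f :* Q := r :- (r :+ f :* Q)) refl (+ rem b j) (+ quot b j) (+ Q) ⟩
    + rem b j ℤ.- (+ rem b j ℤ.+ + quot b j ℤ.* + Q)
      ≡⟨ cong (λ z → + rem b j ℤ.- z) (sym (+-division (q j ℕ.* b) Q)) ⟩
    + rem b j ℤ.- + (q j ℕ.* b)
      ≡⟨ cong (λ z → + rem b j ℤ.- z) (ℤP.pos-* (q j) b) ⟩
    + rem b j ℤ.- + q j ℤ.* + b ∎
    where
    open ≡-Reasoning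
    open ℤ-Solver

  neg-quot : ℕ → Vec ℤ n
  neg-quot b = tabulate (λ j → ℤ.- + quot b j)

  point : ℕ → Vec ℤ (suc n)
  point b = neg-quot b ∷ʳ + ω q b

  point-inject₁ : ∀ b j → lookup (point b) (inject₁ j) ≡ ℤ.- + quot b j
  point-inject₁ b j = trans (lookup-∷ʳ-inject₁ (neg-quot b) (+ ω q b) j) (lookup∘tabulate _ j)

  point-fromℕ : ∀ b → lookup (point b) (fromℕ n) ≡ + ω q b
  point-fromℕ b = lookup-∷ʳ-fromℕ (neg-quot b) (+ ω q b)

  point-injective : ∀ {b b′} → point b ≡ point b′ → b ≡ b′
  point-injective {b} {b′} eq = begin
    b                              ≡⟨ sym (ω+sum-quot b) ⟩
    ω q b  ℕ.+ sumℕ n (quot b)     ≡⟨ cong₂ ℕ._+_ same-ω (sumℕ-cong n same-quot) ⟩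
    ω q b′ ℕ.+ sumℕ n (quot b′)    ≡⟨ ω+sum-quot b′ ⟩
    b′                             ∎
    where
    open ≡-Reasoning
    same-ω : ω q b ≡ ω q b′
    same-ω = ℤP.+-injective (trans (sym (point-fromℕ b)) (trans (cong (λ x → lookup x (fromℕ n)) eq) (point-fromℕ b′)))
    same-quot : quot b ≗ quot b′
    same-quot j = ℤP.+-injective (ℤP.neg-injective
      (trans (sym (point-inject₁ b j)) (trans (cong (λ x → lookup x (inject₁ j)) eq) (point-inject₁ b′ j))))

  K : ℚ
  K = toℚ (+ Q)

  instance
    K-positive : ℚ.Positive K
    K-positive = ℚ.positive (toℚ-mono-< {+ 0} {+ Q} (+<+ (s≤s z≤n)))
    K-nonZero : ℚ.NonZero K
    K-nonZero = ℚP.pos⇒nonZero K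

  toℚ≡÷K : ∀ {z w} → z ℤ.* + Q ≡ w → toℚ z ≡ toℚ w ÷ K
  toℚ≡÷K {z} zQ≡w = *≡⇒≡÷ K (trans (sym (toℚ-homo-* z (+ Q))) (cong toℚ zQ≡w))

  weights : ℕ → Fin (suc n) → ℚ
  weights b zero    = toℚ (+ b) ÷ K
  weights b (suc i) = toℚ (+ rem b i) ÷ K

  weights-open : ∀ {b} → InT q b → ∀ i → (0ℚ ℚ.< weights b i) × (weights b i ℚ.< 1ℚ)
  weights-open (1≤b , b<Q , _) zero = 0<p<K⇒0<p÷K<1 K (toℚ-mono-< (+<+ 1≤b)) (toℚ-mono-< (+<+ b<Q))
  weights-open {b} (_ , _ , Q∤qb) (suc i) =
    0<p<K⇒0<p÷K<1 K (toℚ-mono-< (+<+ 0<rem)) (toℚ-mono-< (+<+ (m%n<n (q i ℕ.* b) Q)))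
    where
    0<rem : 0 ℕ.< rem b i
    0<rem = ℕP.n≢0⇒n>0 (Q∤qb i ∘ m%n≡0⇒n∣m (q i ℕ.* b) Q)

  point-combination-fromℕ : ∀ b →
    toℚ (lookup (point b) (fromℕ n)) ≡ combination (Δ1q q) (weights b) (fromℕ n)
  point-combination-fromℕ b = begin
    toℚ (lookup (point b) (fromℕ n))
      ≡⟨ cong toℚ (point-fromℕ b) ⟩
    toℚ (+ ω q b)
      ≡⟨ toℚ≡÷K {+ ω q b} ωQ≡b+Σrem ⟩
    toℚ (+ b ℤ.+ + sumℕ n (rem b)) ÷ K
      ≡⟨ cong (_÷ K) (toℚ-homo-+ (+ b) (+ sumℕ n (rem b))) ⟩
    (toℚ (+ b) ℚ.+ toℚ (+ sumℕ n (rem b))) ÷ K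
      ≡⟨ ℚP.*-distribʳ-+ (ℚ.1/ K) (toℚ (+ b)) (toℚ (+ sumℕ n (rem b))) ⟩
    toℚ (+ b) ÷ K ℚ.+ toℚ (+ sumℕ n (rem b)) ÷ K
      ≡⟨ cong (λ t → toℚ (+ b) ÷ K ℚ.+ t ÷ K) (toℚ-homo-sumℕ n (rem b)) ⟩
    toℚ (+ b) ÷ K ℚ.+ sumℚ n (toℚ ∘ +_ ∘ rem b) ÷ K
      ≡⟨ cong (toℚ (+ b) ÷ K ℚ.+_) (sumℚ-*ʳ n (toℚ ∘ +_ ∘ rem b) (ℚ.1/ K)) ⟩
    sumℚ (suc n) (weights b)
      ≡⟨ sym (combination-last (Δ1q q) (weights b)) ⟩
    combination (Δ1q q) (weights b) (fromℕ n) ∎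
    where
    open ≡-Reasoning
    ωQ≡b+Σrem : + ω q b ℤ.* + Q ≡ + b ℤ.+ + sumℕ n (rem b)
    ωQ≡b+Σrem = begin
      + ω q b ℤ.* + Q            ≡⟨ sym (ℤP.pos-* (ω q b) Q) ⟩
      + (ω q b ℕ.* Q)            ≡⟨ cong +_ (trans (ℕP.*-comm (ω q b) Q) (Q*ω b)) ⟩
      + (b ℕ.+ sumℕ n (rem b))   ≡⟨ ℤP.pos-+ b (sumℕ n (rem b)) ⟩
      + b ℤ.+ + sumℕ n (rem b)   ∎

  point-combination-inject₁ : ∀ b j →
    toℚ (lookup (point b) (inject₁ j)) ≡ combination (Δ1q q) (weights b) (inject₁ j)
  point-combination-inject₁ b j = begin
    toℚ (lookup (point b) (inject₁ j))
      ≡⟨ cong toℚ (point-inject₁ b j) ⟩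
    toℚ (ℤ.- + quot b j)
      ≡⟨ toℚ≡÷K {ℤ.- + quot b j} (neg-quot*Q b j) ⟩
    toℚ (+ rem b j ℤ.- + q j ℤ.* + b) ÷ K
      ≡⟨ cong (_÷ K) toℚ-r-qb ⟩
    (r ℚ.- qj ℚ.* b′) ÷ K
      ≡⟨ solve 4 (λ r qj b′ k → (r :- qj :* b′) :* k := r :* k :- qj :* (b′ :* k)) refl r qj b′ (ℚ.1/ K) ⟩
    r ÷ K ℚ.- qj ℚ.* (b′ ÷ K)
      ≡⟨ sym (Δ1q-combination-inject₁ q (weights b) j) ⟩
    combination (Δ1q q) (weights b) (inject₁ j) ∎
    where
    open ≡-Reasoning
    open ℚ-Solver
    r qj b′ : ℚ
    r = toℚ (+ rem b j)
    qj = toℚ (+ q j)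
    b′ = toℚ (+ b)
    toℚ-r-qb : toℚ (+ rem b j ℤ.- + q j ℤ.* + b) ≡ r ℚ.- qj ℚ.* b′
    toℚ-r-qb = begin
      toℚ (+ rem b j ℤ.- + q j ℤ.* + b)     ≡⟨ toℚ-homo-+ (+ rem b j) (ℤ.- (+ q j ℤ.* + b)) ⟩
      r ℚ.+ toℚ (ℤ.- (+ q j ℤ.* + b))       ≡⟨ cong (r ℚ.+_) (toℚ-homo‿- (+ q j ℤ.* + b)) ⟩
      r ℚ.- toℚ (+ q j ℤ.* + b)             ≡⟨ cong (λ t → r ℚ.- t) (toℚ-homo-* (+ q j) (+ b)) ⟩
      r ℚ.- qj ℚ.* b′                       ∎

  point-combination : ∀ b → IsCombination (Δ1q q) (weights b) (point b)
  point-combination b j with view j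
  ... | ‵fromℕ     = point-combination-fromℕ b
  ... | ‵inject₁ j = point-combination-inject₁ b j

  module _ {λs : Fin (suc n) → ℚ} {x : Vec ℤ (suc n)} (x≈ : IsCombination (Δ1q q) λs x) where
    private
      X : Fin n → ℤ
      X j = lookup x (inject₁ j)
      L : ℤ
      L = lookup x (fromℕ n)

    Δ1q-weight-suc : ∀ j → λs (suc j) ≡ toℚ (X j) ℚ.+ toℚ (+ q j) ℚ.* λs zero
    Δ1q-weight-suc j = begin
      λs (suc j)
        ≡⟨ solve 3 (λ l l₀ qj → l := (l :- qj :* l₀) :+ qj :* l₀) refl (λs (suc j)) (λs zero) (toℚ (+ q j)) ⟩
      λs (suc j) ℚ.- toℚ (+ q j) ℚ.* λs zero ℚ.+ toℚ (+ q j) ℚ.* λs zero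
        ≡⟨ cong (ℚ._+ toℚ (+ q j) ℚ.* λs zero) (sym (trans (x≈ (inject₁ j)) (Δ1q-combination-inject₁ q λs j))) ⟩
      toℚ (X j) ℚ.+ toℚ (+ q j) ℚ.* λs zero ∎
      where
      open ≡-Reasoning
      open ℚ-Solver

    Δ1q-weight-zero*K : λs zero ℚ.* K ≡ toℚ (L ℤ.- ℤΣ.sum X)
    Δ1q-weight-zero*K = begin
      λs zero ℚ.* K
        ≡⟨ cong (λs zero ℚ.*_) (toℚ-homo-+ (+ 1) (+ S)) ⟩
      λs zero ℚ.* (1ℚ ℚ.+ s)
        ≡⟨ solve 3 (λ l₀ t s → l₀ :* (con 1ℚ :+ s) := (l₀ :+ (t :+ s :* l₀)) :- t) refl (λs zero) t s ⟩
      (λs zero ℚ.+ (t ℚ.+ s ℚ.* λs zero)) ℚ.- t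
        ≡⟨ cong (λ u → (λs zero ℚ.+ u) ℚ.- t) (sym sum-weights-suc) ⟩
      sumℚ (suc n) λs ℚ.- t
        ≡⟨ cong (ℚ._- t) (sym (trans (x≈ (fromℕ n)) (combination-last (Δ1q q) λs))) ⟩
      toℚ L ℚ.- t
        ≡⟨ cong (toℚ L ℚ.+_) (sym (toℚ-homo‿- (ℤΣ.sum X))) ⟩
      toℚ L ℚ.+ toℚ (ℤ.- ℤΣ.sum X)
        ≡⟨ sym (toℚ-homo-+ L (ℤ.- ℤΣ.sum X)) ⟩
      toℚ (L ℤ.- ℤΣ.sum X) ∎
      where
      open ≡-Reasoning
      open ℚ-Solver
      s t : ℚ
      s = toℚ (+ S)
      t = toℚ (ℤΣ.sum X)
      sum-weights-suc : sumℚ n (λs ∘ suc) ≡ t ℚ.+ s ℚ.* λs zero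
      sum-weights-suc = begin
        sumℚ n (λs ∘ suc)
          ≡⟨ sumℚ-cong n Δ1q-weight-suc ⟩
        sumℚ n (λ j → toℚ (X j) ℚ.+ toℚ (+ q j) ℚ.* λs zero)
          ≡⟨ sumℚ-+ n (toℚ ∘ X) (λ j → toℚ (+ q j) ℚ.* λs zero) ⟩
        sumℚ n (toℚ ∘ X) ℚ.+ sumℚ n (λ j → toℚ (+ q j) ℚ.* λs zero)
          ≡⟨ cong (sumℚ n (toℚ ∘ X) ℚ.+_) (sym (sumℚ-*ʳ n (λ j → toℚ (+ q j)) (λs zero))) ⟩
        sumℚ n (toℚ ∘ X) ℚ.+ sumℚ n (λ j → toℚ (+ q j)) ℚ.* λs zero
          ≡⟨ cong₂ (λ u v → u ℚ.+ v ℚ.* λs zero) (sym (toℚ-homo-∑ n X)) (sym (toℚ-homo-sumℕ n q)) ⟩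
        t ℚ.+ s ℚ.* λs zero ∎

  0<μ<1⇒0<μQ<Q : ∀ {μ z} → 0ℚ ℚ.< μ → μ ℚ.< 1ℚ → μ ℚ.* K ≡ toℚ z → (+ 0 ℤ.< z) × (z ℤ.< + Q)
  0<μ<1⇒0<μQ<Q 0<μ μ<1 μK≡z with 0<μ<1⇒0<μ*K<K K 0<μ μ<1
  ... | 0<μK , μK<K = toℚ-cancel-< (subst (0ℚ ℚ.<_) μK≡z 0<μK) , toℚ-cancel-< (subst (ℚ._< K) μK≡z μK<K)

  open-combination⇒weights : ∀ {λs x} → (∀ i → (0ℚ ℚ.< λs i) × (λs i ℚ.< 1ℚ)) → IsCombination (Δ1q q) λs x →
                 Σ[ b ∈ ℕ ] (InT q b × weights b ≗ λs)
  open-combination⇒weights {λs} {x} λs-open x≈ = b , (1≤b , b<Q , Q∤qb) , weights≗λs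
    where
    X : Fin n → ℤ
    X j = lookup x (inject₁ j)
    B : ℤ
    B = lookup x (fromℕ n) ℤ.- ℤΣ.sum X
    0<B<Q : (+ 0 ℤ.< B) × (B ℤ.< + Q)
    0<B<Q = 0<μ<1⇒0<μQ<Q {z = B} (proj₁ (λs-open zero)) (proj₂ (λs-open zero)) (Δ1q-weight-zero*K {λs = λs} {x = x} x≈)
    b : ℕ
    b = ℤ.∣ B ∣
    b≡B : + b ≡ B
    b≡B = ℤP.0≤i⇒+∣i∣≡i (ℤP.<⇒≤ (proj₁ 0<B<Q))
    1≤b : 1 ℕ.≤ b
    1≤b = ℤP.drop‿+<+ (subst (+ 0 ℤ.<_) (sym b≡B) (proj₁ 0<B<Q))
    b<Q : b ℕ.< Q
    b<Q = ℤP.drop‿+<+ (subst (ℤ._< + Q) (sym b≡B) (proj₂ 0<B<Q))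
    weight-zero : λs zero ℚ.* K ≡ toℚ (+ b)
    weight-zero = trans (Δ1q-weight-zero*K {λs = λs} {x = x} x≈) (cong toℚ (sym b≡B))
    weight-suc : ∀ j → λs (suc j) ℚ.* K ≡ toℚ (X j ℤ.* + Q ℤ.+ + (q j ℕ.* b))
    weight-suc j = begin
      λs (suc j) ℚ.* K
        ≡⟨ cong (ℚ._* K) (Δ1q-weight-suc {λs = λs} {x = x} x≈ j) ⟩
      (toℚ (X j) ℚ.+ toℚ (+ q j) ℚ.* λs zero) ℚ.* K
        ≡⟨ solve 4 (λ x qj l₀ k → (x :+ qj :* l₀) :* k := x :* k :+ qj :* (l₀ :* k)) refl (toℚ (X j)) (toℚ (+ q j)) (λs zero) K ⟩
      toℚ (X j) ℚ.* K ℚ.+ toℚ (+ q j) ℚ.* (λs zero ℚ.* K)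
        ≡⟨ cong (λ u → toℚ (X j) ℚ.* K ℚ.+ toℚ (+ q j) ℚ.* u) weight-zero ⟩
      toℚ (X j) ℚ.* K ℚ.+ toℚ (+ q j) ℚ.* toℚ (+ b)
        ≡⟨ sym (cong₂ ℚ._+_ (toℚ-homo-* (X j) (+ Q)) (toℚ-homo-* (+ q j) (+ b))) ⟩
      toℚ (X j ℤ.* + Q) ℚ.+ toℚ (+ q j ℤ.* + b)
        ≡⟨ sym (toℚ-homo-+ (X j ℤ.* + Q) (+ q j ℤ.* + b)) ⟩
      toℚ (X j ℤ.* + Q ℤ.+ + q j ℤ.* + b)
        ≡⟨ cong (λ z → toℚ (X j ℤ.* + Q ℤ.+ z)) (sym (ℤP.pos-* (q j) b)) ⟩
      toℚ (X j ℤ.* + Q ℤ.+ + (q j ℕ.* b)) ∎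
      where
      open ≡-Reasoning
      open ℚ-Solver
    0<z<Q : ∀ j → (+ 0 ℤ.< X j ℤ.* + Q ℤ.+ + (q j ℕ.* b)) × (X j ℤ.* + Q ℤ.+ + (q j ℕ.* b) ℤ.< + Q)
    0<z<Q j = 0<μ<1⇒0<μQ<Q {z = X j ℤ.* + Q ℤ.+ + (q j ℕ.* b)} (proj₁ (λs-open (suc j))) (proj₂ (λs-open (suc j))) (weight-suc j)
    z≡rem : ∀ j → X j ℤ.* + Q ℤ.+ + (q j ℕ.* b) ≡ + rem b j
    z≡rem j = remainder-unique (X j) (q j ℕ.* b) Q (ℤP.<⇒≤ (proj₁ (0<z<Q j))) (proj₂ (0<z<Q j))
    Q∤qb : ∀ j → ¬ (Q ∣ q j ℕ.* b)
    Q∤qb j Q∣qb = ℤP.<-irrefl (sym (trans (z≡rem j) (cong +_ (n∣m⇒m%n≡0 (q j ℕ.* b) Q Q∣qb)))) (proj₁ (0<z<Q j))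
    weights≗λs : weights b ≗ λs
    weights≗λs zero    = sym (*≡⇒≡÷ K weight-zero)
    weights≗λs (suc j) = sym (*≡⇒≡÷ K (trans (weight-suc j) (cong toℚ (z≡rem j))))

theorem2p1 : (n : ℕ) → 1 ≤ n → (q : Fin n → ℕ) → (∀ i → 1 ≤ q i) →
    LocalHStarEq (Δ1q q) (InT q) (ω q)
theorem2p1 n _ q _ = point q , lattice-point , injective , surjective
  where
  lattice-point : ∀ b → InT q b → InOpenParallelepiped (Δ1q q) (point q b) × (lookup (point q b) (fromℕ n) ≡ + ω q b)
  lattice-point b b∈T = (weights q b , weights-open q b∈T , point-combination q b) , point-fromℕ q b
  injective : ∀ b b′ → InT q b → InT q b′ → point q b ≡ point q b′ → b ≡ b′
  injective _ _ _ _ = point-injective q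
  surjective : ∀ x → InOpenParallelepiped (Δ1q q) x → Σ[ b ∈ ℕ ] (InT q b × point q b ≡ x)
  surjective x (λs , λs-open , x≈) =
    let b , b∈T , weights≗λs = open-combination⇒weights q {λs} {x} λs-open x≈
        x≈′ : IsCombination (Δ1q q) (weights q b) x
        x≈′ j = trans (x≈ j) (combination-cong (Δ1q q) (sym ∘ weights≗λs) j)
    in b , b∈T , IsCombination-unique (Δ1q q) (weights q b) (point-combination q b) x≈′
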